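{- Let $X$ be a geometric distance-regular graph of diameter $d\geq 2$ with a Delsarte clique geometry $\mathcal C$ and smallest eigenvalue $-m$. (1) If $\psi_1=1$, then for each vertex $v$ the neighborhood graph $X(v)$ is a disjoint union of $m$ cliques. (2) If $\psi_1\geq 2$, then for each vertex $v$ the neighborhood graph $X(v)$ is connected. In particular, either every neighborhood graph of $X$ is connected or every neighborhood graph of $X$ is disconnected.
   Context: A connected graph of diameter $d$ is distance-regular if for each $0\le i\le d$ there are constants $a_i,b_i,c_i$ such that for any vertices $v,w$ at distance $i$, $w$ has exactly $c_i$, $a_i$, $b_i$ neighbors at distance $i-1$, $i$, $i+1$ from $v$; $k=b_0$. A Delsarte clique is a clique of size $1-k/\theta_{\min}$ ($\theta_{\min}$ the smallest eigenvalue); a Delsarte clique geometry is a collection $\mathcal C$ of Delsarte cliques such that every edge lies in exactly one member; $X$ is geometric if one exists. $X(v)$ is the subgraph induced on the neighbors of $v$. For $C\in\mathcal C$ and a vertex $x$ with $\mathrm{dist}(x,C)=1$, the number of neighbors of $x$ in $C$ does not depend on the choices and is denoted $\psi_1$. -}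

module Defs where

open import Data.Nat using (ℕ; zero; suc; _∸_; _<_; _≤_)
open import Data.Fin using (Fin; zero; suc)
open import Data.Bool using (Bool; true; false; T)
open import Data.Vec using (Vec)
open import Data.Vec.Relation.Unary.Unique.Propositional using (Unique)
open import Data.Vec.Membership.Propositional using () renaming (_∈_ to _∈ᵥ_)
open import Data.Fin.Subset using (Subset; _∈_; _∉_; ∣_∣)
open import Data.Integer using (+_)
open import Data.Rational as ℚ using (ℚ; 0ℚ; _/_)
open import Data.Product using (Σ; ∃; _×_; Σ-syntax; ∃-syntax)
open import Data.Empty using (⊥)
open import Relation.Nullary using (¬_)
open import Relation.Binary.PropositionalEquality using (_≡_; _≢_)
open import Function.Bundles using (_⇔_)

-- Finite simple graphs on the vertex set Fin n (adjacency given as a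
-- Boolean matrix, so that the adjacency matrix is available).

record Graph (n : ℕ) : Set where
  field
    adj     : Fin n → Fin n → Bool
    symm    : ∀ u v → adj u v ≡ adj v u
    irrefl  : ∀ u → adj u u ≡ false

module _ {n : ℕ} (G : Graph n) where
  open Graph G

  Adj : Fin n → Fin n → Set
  Adj u v = T (adj u v)

  data Walk : Fin n → Fin n → ℕ → Set where
    stop : ∀ {v} → Walk v v 0
    step : ∀ {u v w i} → Adj u v → Walk v w i → Walk u w (suc i)

  Dist : Fin n → Fin n → ℕ → Set
  Dist v w i = Walk v w i × (∀ j → j < i → ¬ Walk v w j)

  Card : (Fin n → Set) → ℕ → Set
  Card P c = Σ[ xs ∈ Vec (Fin n) c ] (Unique xs × (∀ u → P u ⇔ u ∈ᵥ xs))

  HasDiameter : ℕ → Set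
  HasDiameter d = (∀ v w → ∃[ i ] (i ≤ d × Dist v w i))
                × (∃[ v ] ∃[ w ] Dist v w d)

  -- distance-regular of diameter d with intersection numbers a_i, b_i, c_i
  -- (k = b 0)
  IsDRG : ℕ → (a b c : ℕ → ℕ) → Set
  IsDRG d a b c =
    HasDiameter d ×
    (∀ i → i ≤ d → ∀ v w → Dist v w i →
        Card (λ u → Adj w u × Dist v u (i ∸ 1)) (c i)
      × Card (λ u → Adj w u × Dist v u i) (a i)
      × Card (λ u → Adj w u × Dist v u (suc i)) (b i))

  A : Fin n → Fin n → ℚ
  A u v with adj u v
  ... | true  = ℚ.1ℚ
  ... | false = ℚ.0ℚ

  IsEigenvalue : ℚ → Set
  IsEigenvalue θ = Σ[ x ∈ (Fin n → ℚ) ] ((∃[ i ] x i ≢ 0ℚ) ×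
                     (∀ i → ∑ (λ j → A i j ℚ.* x j) ≡ θ ℚ.* x i))
    where
    ∑ : {m : ℕ} → (Fin m → ℚ) → ℚ
    ∑ {zero}  f = 0ℚ
    ∑ {suc m} f = f zero ℚ.+ ∑ (λ j → f (suc j))

  IsSmallestEigenvalue : ℚ → Set
  IsSmallestEigenvalue θ = IsEigenvalue θ × (∀ μ → IsEigenvalue μ → θ ℚ.≤ μ)

  toℚ : ℕ → ℚ
  toℚ k = (+ k) / 1

  IsClique : Subset n → Set
  IsClique C = ∀ u v → u ∈ C → v ∈ C → u ≢ v → Adj u v

  -- Delsarte clique: a clique of size 1 - k/θ_min, here θ_min = -m,
  -- i.e. of size 1 + k/m; written multiplicatively as (|C| - 1)·m = k
  IsDelsarteClique : (k : ℕ) (m : ℚ) → Subset n → Set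
  IsDelsarteClique k m C = IsClique C × ((toℚ ∣ C ∣ ℚ.- ℚ.1ℚ) ℚ.* m ≡ toℚ k)

  IsDelsarteGeometry : (k : ℕ) (m : ℚ) {N : ℕ} → (Fin N → Subset n) → Set
  IsDelsarteGeometry k m {N} 𝒞 =
    (∀ i → IsDelsarteClique k m (𝒞 i)) ×
    (∀ u v → Adj u v → Σ[ i ∈ Fin N ] ((u ∈ 𝒞 i × v ∈ 𝒞 i) ×
        (∀ j → u ∈ 𝒞 j → v ∈ 𝒞 j → j ≡ i)))

  DistOne : Fin n → Subset n → Set
  DistOne x C = x ∉ C × ∃[ y ] (y ∈ C × Adj x y)

  IsPsi1 : {N : ℕ} → (Fin N → Subset n) → ℕ → Set
  IsPsi1 {N} 𝒞 ψ = ∀ (i : Fin N) x → DistOne x (𝒞 i) →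
                     Card (λ y → y ∈ 𝒞 i × Adj x y) ψ

  data LocalPath (v : Fin n) : Fin n → Fin n → Set where
    here  : ∀ {u} → LocalPath v u u
    there : ∀ {u w z} → Adj v w → Adj u w → LocalPath v w z → LocalPath v u z

  NbhdConnected : Fin n → Set
  NbhdConnected v = ∀ u w → Adj v u → Adj v w → LocalPath v u w

  NbhdUnionOfCliques : Fin n → ℕ → Set
  NbhdUnionOfCliques v r =
    Σ[ f ∈ ((u : Fin n) → Adj v u → Fin r) ]
      ((∀ (j : Fin r) → ∃[ u ] Σ[ p ∈ Adj v u ] f u p ≡ j) ×
       (∀ u w (p : Adj v u) (q : Adj v w) → u ≢ w →
          (Adj u w ⇔ (f u p ≡ f w q))))

module Submission where

-- Fix a Delsarte geometry 𝒞 (its members are called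
-- lines) with ψ₁ = ψ.  A pair of vertices at distance d ≥ 2 yields an
-- induced path x – y – z, so the degree k is positive.  From the Delsarte
-- equation (|C| - 1)·m = k and k ≠ 0 all lines have the same size s + 1,
-- with s·m = k.  Since the lines through v partition the neighbourhood of
-- v, double counting gives k = r(v)·s, where r(v) is the number of lines
-- through v; hence r(v) = m for every v.
--   If ψ = 1, a triangle never leaves the line of one of its edges, so
-- "lying on the same line through v" splits X(v) into r(v) = m cliques.
-- If ψ ≥ 2, a neighbour w of v off the line of vu sees a second point of
-- that line, which links u to w inside X(v).  Finally ψ ≠ 0 (the end z of
-- the induced path sees y on the line of xy), and in the case ψ = 1 the
-- induced path shows r(y) ≥ 2, hence r(v) = r(y) ≥ 2 for all v.

open import Defs
open import Data.Nat using (ℕ; _≤_)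
open import Data.Fin using (Fin)
open import Data.Fin.Subset using (Subset)
open import Data.Rational using (ℚ; -_)
open import Data.Product using (_×_; Σ-syntax)
open import Data.Sum using (_⊎_)
open import Relation.Nullary using (¬_)
open import Relation.Binary.PropositionalEquality using (_≡_)

open import Data.Nat using (zero; suc; _+_; _*_; _<_; s≤s; z≤n)
import Data.Nat.Properties as ℕP
open import Data.Fin using (zero; suc; _≟_; punchIn)
open import Data.Fin.Properties using (punchInᵢ≢i; suc-injective)
open import Data.Fin.Subset using (_∈_; _∉_; ∣_∣)
open import Data.Fin.Subset.Properties using (_∈?_)
open import Data.Bool using (Bool; true; false; T; _∧_; not)
open import Data.Bool.Properties using (T-≡; T-∧; T-irrelevant; ∧-zeroʳ; ∧-identityʳ)
open import Data.Product using (_,_; proj₁; proj₂; ∃-syntax)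
open import Data.Sum using (inj₁; inj₂)
open import Data.Vec using (Vec; []; _∷_; lookup)
open import Data.Vec.Properties using ([]=⇒lookup; lookup⇒[]=)
open import Data.Vec.Relation.Unary.AllPairs using ([]; _∷_)
open import Data.Vec.Relation.Unary.All using ([])
import Data.Vec.Relation.Unary.All as All
open import Data.Vec.Relation.Unary.Any using (here; there)
open import Data.Vec.Relation.Unary.Unique.Propositional using (Unique)
open import Data.Vec.Membership.Propositional using () renaming (_∈_ to _∈ᵥ_)
open import Data.Integer as ℤ using (+_)
import Data.Integer.Properties as ℤP
open import Data.Nat.Coprimality using (1-coprimeTo) renaming (sym to coprime-sym)
open import Data.Rational using (mkℚ; _/_; 0ℚ; 1ℚ; _-_; 1/_; ≢-nonZero; NonZero)
  renaming (_+_ to _+ℚ_; _*_ to _*ℚ_)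
import Data.Rational.Properties as ℚP
open import Algebra.Properties.Group ℚP.+-0-group using (∙-cancelʳ; //-rightDividesʳ)
open import Algebra.Properties.Semiring.Sum ℕP.+-*-semiring
  using (sum; sum-cong-≗; sum-replicate-zero; sum-remove; ∑-comm; *-distribʳ-sum)
open import Function using (_∘_)
open import Function.Bundles using (_⇔_; mk⇔; Equivalence)
open import Relation.Nullary using (yes; no; does; contradiction)
open import Relation.Binary.PropositionalEquality
  using (_≢_; refl; sym; trans; cong; cong₂; subst; module ≡-Reasoning)

open Equivalence using (to; from)

⟦_⟧ : Bool → ℕ
⟦ true ⟧  = 1
⟦ false ⟧ = 0

count : ∀ {N} → (Fin N → Bool) → ℕ
count g = sum (λ i → ⟦ g i ⟧)

sum-zero : ∀ {N} (f : Fin N → ℕ) → (∀ i → f i ≡ 0) → sum f ≡ 0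
sum-zero {N} f f≡0 = trans (sum-cong-≗ f≡0) (sum-replicate-zero N)

_∖_ : ∀ {N} → (Fin N → Bool) → Fin N → (Fin N → Bool)
(g ∖ v) u = g u ∧ not (does (u ≟ v))

∖-self : ∀ {N} (g : Fin N → Bool) v → (g ∖ v) v ≡ false
∖-self g v with v ≟ v
... | yes _   = ∧-zeroʳ (g v)
... | no v≢v  = contradiction refl v≢v

∖-other : ∀ {N} (g : Fin N → Bool) {u v} → u ≢ v → (g ∖ v) u ≡ g u
∖-other g {u} {v} u≢v with u ≟ v
... | yes u≡v = contradiction u≡v u≢v
... | no _    = ∧-identityʳ (g u)

∖-intro : ∀ {N} (g : Fin N → Bool) {u v} → T (g u) → u ≢ v → T ((g ∖ v) u)
∖-intro g gu u≢v = subst T (sym (∖-other g u≢v)) gu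

∖-elim : ∀ {N} (g : Fin N → Bool) {u v} → T ((g ∖ v) u) → T (g u) × u ≢ v
∖-elim g {u} {v} t = subst T (∖-other g u≢v) t , u≢v
  where
  u≢v : u ≢ v
  u≢v u≡v = subst T (trans (cong (g ∖ v) u≡v) (∖-self g v)) t

count-remove : ∀ {N} (g : Fin N → Bool) v → T (g v) → count g ≡ suc (count (g ∖ v))
count-remove {suc N} g v gv = begin
  count g                                     ≡⟨ sum-remove {i = v} ind ⟩
  ⟦ g v ⟧ + sum (λ j → ind (punchIn v j))     ≡⟨ cong₂ _+_ (cong ⟦_⟧ (to T-≡ gv)) (sum-cong-≗ agree) ⟩
  suc (sum (λ j → ind∖ (punchIn v j)))        ≡⟨ cong (λ b → suc (⟦ b ⟧ + sum (λ j → ind∖ (punchIn v j)))) (sym (∖-self g v)) ⟩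
  suc (⟦ (g ∖ v) v ⟧ + sum (λ j → ind∖ (punchIn v j))) ≡⟨ cong suc (sym (sum-remove {i = v} ind∖)) ⟩
  suc (count (g ∖ v))                         ∎
  where
  open ≡-Reasoning
  ind ind∖ : Fin (suc N) → ℕ
  ind  u = ⟦ g u ⟧
  ind∖ u = ⟦ (g ∖ v) u ⟧
  agree : ∀ j → ind (punchIn v j) ≡ ind∖ (punchIn v j)
  agree j = cong ⟦_⟧ (sym (∖-other g (punchInᵢ≢i v j)))

count-witness : ∀ {N} (g : Fin N → Bool) → 1 ≤ count g → ∃[ i ] T (g i)
count-witness {suc N} g pos with g zero in g₀
... | true  = zero , from T-≡ g₀
... | false with count-witness (g ∘ suc) pos
...   | i , t = suc i , t

count-vector : ∀ {N c} (g : Fin N → Bool) (xs : Vec (Fin N) c) → Unique xs →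
               (∀ u → T (g u) ⇔ u ∈ᵥ xs) → count g ≡ c
count-vector g [] _ g⇔∈ = sum-zero _ absent
  where
  absent : ∀ u → ⟦ g u ⟧ ≡ 0
  absent u with g u in gu
  ... | false = refl
  ... | true with to (g⇔∈ u) (from T-≡ gu)
  ...   | ()
count-vector g (x ∷ xs) (x∉xs ∷ unique) g⇔∈ =
  trans (count-remove g x (from (g⇔∈ x) (here refl)))
        (cong suc (count-vector (g ∖ x) xs unique g∖x⇔∈))
  where
  g∖x⇔∈ : ∀ u → T ((g ∖ x) u) ⇔ u ∈ᵥ xs
  g∖x⇔∈ u = mk⇔ forth back
    where
    forth : T ((g ∖ x) u) → u ∈ᵥ xs
    forth t with ∖-elim g t
    ... | gu , u≢x with to (g⇔∈ u) gu
    ...   | here u≡x   = contradiction u≡x u≢x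
    ...   | there u∈xs = u∈xs
    back : u ∈ᵥ xs → T ((g ∖ x) u)
    back u∈xs = ∖-intro g (from (g⇔∈ u) (there u∈xs)) (λ u≡x → All.lookup x∉xs u∈xs (sym u≡x))

count-none : ∀ {N} (g : Fin N → Bool) → (∀ i → ¬ T (g i)) → count g ≡ 0
count-none g none = count-vector g [] [] (λ u → mk⇔ (λ t → contradiction t (none u)) (λ ()))

count-single : ∀ {N} (g : Fin N → Bool) i → (∀ j → T (g j) ⇔ j ≡ i) → count g ≡ 1
count-single g i g⇔i = count-vector g (i ∷ []) ([] ∷ [])
  (λ j → mk⇔ (here ∘ to (g⇔i j)) (λ { (here j≡i) → from (g⇔i j) j≡i }))

count-∧ : ∀ {N} b (g : Fin N → Bool) → count (λ u → b ∧ g u) ≡ ⟦ b ⟧ * count g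
count-∧ true  g = sym (ℕP.+-identityʳ (count g))
count-∧ {N} false g = sum-zero {N} (λ _ → 0) (λ _ → refl)

∈⇒T : ∀ {n} {C : Subset n} {u} → u ∈ C → T (lookup C u)
∈⇒T u∈C = from T-≡ ([]=⇒lookup u∈C)

T⇒∈ : ∀ {n} {C : Subset n} {u} → T (lookup C u) → u ∈ C
T⇒∈ {C = C} {u} t = lookup⇒[]= u C (to T-≡ t)

size-count : ∀ {n} (C : Subset n) → ∣ C ∣ ≡ count (lookup C)
size-count []          = refl
size-count (true ∷ C)  = cong suc (size-count C)
size-count (false ∷ C) = size-count C

nonempty-size : ∀ {n} {C : Subset n} {u} → u ∈ C → Σ[ s ∈ ℕ ] ∣ C ∣ ≡ suc s
nonempty-size {C = C} {u} u∈C =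
  _ , trans (size-count C) (count-remove (lookup C) u (∈⇒T u∈C))

record Enumeration {N} (g : Fin N → Bool) (r : ℕ) : Set where
  field
    index      : ∀ i → T (g i) → Fin r
    injective  : ∀ {i j} (p : T (g i)) (q : T (g j)) → index i p ≡ index j q → i ≡ j
    surjective : ∀ a → ∃[ i ] Σ[ p ∈ T (g i) ] index i p ≡ a

  index-cong : ∀ {i j} (p : T (g i)) (q : T (g j)) → i ≡ j → index i p ≡ index j q
  index-cong p q refl = cong (index _) (T-irrelevant p q)

extend : ∀ {N r} (g : Fin (suc N) → Bool) b → g zero ≡ b →
         Enumeration (g ∘ suc) r → Enumeration g (⟦ b ⟧ + r)
extend g false g₀ E = record { index = index ; injective = injective ; surjective = surjective }
  where
  module E = Enumeration E
  index : ∀ i → T (g i) → Fin _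
  index zero    p = contradiction (subst T g₀ p) λ ()
  index (suc i) p = E.index i p
  injective : ∀ {i j} (p : T (g i)) (q : T (g j)) → index i p ≡ index j q → i ≡ j
  injective {zero}  p _ _ = contradiction (subst T g₀ p) λ ()
  injective {suc i} {zero} _ q _ = contradiction (subst T g₀ q) λ ()
  injective {suc i} {suc j} p q e = cong suc (E.injective p q e)
  surjective : ∀ a → ∃[ i ] Σ[ p ∈ T (g i) ] index i p ≡ a
  surjective a with E.surjective a
  ... | i , p , e = suc i , p , e
extend g true g₀ E = record { index = index ; injective = injective ; surjective = surjective }
  where
  module E = Enumeration E
  index : ∀ i → T (g i) → Fin _
  index zero    _ = zero
  index (suc i) p = suc (E.index i p)
  injective : ∀ {i j} (p : T (g i)) (q : T (g j)) → index i p ≡ index j q → i ≡ j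
  injective {zero}  {zero}  _ _ _  = refl
  injective {suc i} {suc j} p q e = cong suc (E.injective p q (suc-injective e))
  surjective : ∀ a → ∃[ i ] Σ[ p ∈ T (g i) ] index i p ≡ a
  surjective zero = zero , subst T (sym g₀) _ , refl
  surjective (suc a) with E.surjective a
  ... | i , p , e = suc i , p , cong suc e

enumerate : ∀ {N} (g : Fin N → Bool) → Enumeration g (count g)
enumerate {zero}  g = record { index = λ () ; injective = λ { {()} } ; surjective = λ () }
enumerate {suc N} g = extend g (g zero) refl (enumerate (g ∘ suc))

-- Rational arithmetic of the Delsarte equation.  fromℕ is the embedding
-- ℕ → ℚ; it coincides definitionally with toℚ X of Defs.

fromℕ : ℕ → ℚ
fromℕ k = + k / 1

fromℕ-normal : ∀ k → fromℕ k ≡ mkℚ (+ k) 0 (coprime-sym (1-coprimeTo k))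
fromℕ-normal k = ℚP.normalize-coprime (coprime-sym (1-coprimeTo k))

fromℕ-injective : ∀ {a b} → fromℕ a ≡ fromℕ b → a ≡ b
fromℕ-injective {a} {b} e =
  ℤP.+-injective (cong ℚ.numerator (trans (sym (fromℕ-normal a)) (trans e (fromℕ-normal b))))

fromℕ-* : ∀ a b → fromℕ (a * b) ≡ fromℕ a *ℚ fromℕ b
fromℕ-* a b rewrite fromℕ-normal a | fromℕ-normal b = cong (_/ 1) (ℤP.pos-* a b)

fromℕ-suc : ∀ s → fromℕ (suc s) ≡ fromℕ s +ℚ 1ℚ
fromℕ-suc s rewrite fromℕ-normal s =
  cong (_/ 1) (trans (cong +_ (ℕP.+-comm 1 s)) (cong (ℤ._+ + 1) (sym (ℤP.*-identityʳ (+ s)))))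

*-cancelʳ : ∀ {x y} m → m ≢ 0ℚ → x *ℚ m ≡ y *ℚ m → x ≡ y
*-cancelʳ {x} {y} m m≢0 e = begin
  x                    ≡⟨ sym (ℚP.*-identityʳ x) ⟩
  x *ℚ 1ℚ              ≡⟨ cong (x *ℚ_) (sym (ℚP.*-inverseʳ m)) ⟩
  x *ℚ (m *ℚ 1/ m)     ≡⟨ sym (ℚP.*-assoc x m (1/ m)) ⟩
  (x *ℚ m) *ℚ 1/ m     ≡⟨ cong (_*ℚ 1/ m) e ⟩
  (y *ℚ m) *ℚ 1/ m     ≡⟨ ℚP.*-assoc y m (1/ m) ⟩
  y *ℚ (m *ℚ 1/ m)     ≡⟨ cong (y *ℚ_) (ℚP.*-inverseʳ m) ⟩
  y *ℚ 1ℚ              ≡⟨ ℚP.*-identityʳ y ⟩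
  y                    ∎
  where
  open ≡-Reasoning
  instance
    m-nonZero : NonZero m
    m-nonZero = ≢-nonZero m≢0

factor-≢0 : ∀ {x m k} → x *ℚ m ≡ fromℕ k → k ≢ 0 → m ≢ 0ℚ
factor-≢0 {x} e k≢0 m≡0 =
  k≢0 (fromℕ-injective (trans (sym e) (trans (cong (x *ℚ_) m≡0) (ℚP.*-zeroʳ x))))

delsarte-equal : ∀ {a b k m} → k ≢ 0 →
  (fromℕ a - 1ℚ) *ℚ m ≡ fromℕ k → (fromℕ b - 1ℚ) *ℚ m ≡ fromℕ k → a ≡ b
delsarte-equal {a} {b} {m = m} k≢0 ea eb = fromℕ-injective (∙-cancelʳ (- 1ℚ) (fromℕ a) (fromℕ b)
  (*-cancelʳ m (factor-≢0 {fromℕ a - 1ℚ} ea k≢0) (trans ea (sym eb))))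

delsarte-pred : ∀ {s k m} → (fromℕ (suc s) - 1ℚ) *ℚ m ≡ fromℕ k → fromℕ s *ℚ m ≡ fromℕ k
delsarte-pred {s} {k} {m} e = begin
  fromℕ s *ℚ m                     ≡⟨ cong (_*ℚ m) (sym (//-rightDividesʳ 1ℚ (fromℕ s))) ⟩
  ((fromℕ s +ℚ 1ℚ) - 1ℚ) *ℚ m      ≡⟨ cong (λ x → (x - 1ℚ) *ℚ m) (sym (fromℕ-suc s)) ⟩
  (fromℕ (suc s) - 1ℚ) *ℚ m        ≡⟨ e ⟩
  fromℕ k                          ∎
  where open ≡-Reasoning

ratio : ∀ {r s k m} → k ≢ 0 → k ≡ r * s → fromℕ s *ℚ m ≡ fromℕ k → fromℕ r ≡ m
ratio {r} {s} {k} {m} k≢0 k≡rs e = *-cancelʳ (fromℕ s) s≢0 (begin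
  fromℕ r *ℚ fromℕ s  ≡⟨ sym (fromℕ-* r s) ⟩
  fromℕ (r * s)       ≡⟨ cong fromℕ (sym k≡rs) ⟩
  fromℕ k             ≡⟨ sym e ⟩
  fromℕ s *ℚ m        ≡⟨ ℚP.*-comm (fromℕ s) m ⟩
  m *ℚ fromℕ s        ∎)
  where
  open ≡-Reasoning
  s≢0 : fromℕ s ≢ 0ℚ
  s≢0 = factor-≢0 {m} (trans (ℚP.*-comm m (fromℕ s)) e) k≢0

natural-factor-≢0 : ∀ {s k m} → fromℕ s *ℚ m ≡ fromℕ k → k ≢ 0 → s ≢ 0
natural-factor-≢0 {m = m} e k≢0 refl = k≢0 (fromℕ-injective (trans (sym e) (ℚP.*-zeroˡ m)))

record InducedPath {n} (X : Graph n) : Set where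
  field
    x y z : Fin n
    x~y   : Adj X x y
    y~z   : Adj X y z
    x≢z   : x ≢ z
    x≁z   : ¬ Adj X x z

module GraphFacts {n} (X : Graph n) where
  open Graph X

  adj-sym : ∀ {u v} → Adj X u v → Adj X v u
  adj-sym {u} {v} = subst T (symm u v)

  adj-≢ : ∀ {u v} → Adj X u v → u ≢ v
  adj-≢ {u} u~v refl = subst T (irrefl u) u~v

  dist-zero : ∀ v → Dist X v v 0
  dist-zero v = stop , λ _ ()

  dist-one : ∀ {v u} → Adj X v u → Dist X v u 1
  dist-one v~u = step v~u stop , shorter
    where
    shorter : ∀ j → j < 1 → ¬ Walk X _ _ j
    shorter zero    _         stop = adj-≢ v~u refl
    shorter (suc j) (s≤s ())

  degree : ∀ {d a b c} → IsDRG X d a b c → ∀ v → count (adj v) ≡ b 0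
  degree (_ , regular) v with proj₂ (proj₂ (regular 0 z≤n v v (dist-zero v)))
  ... | xs , unique , N⇔∈ = count-vector (adj v) xs unique λ u →
    mk⇔ (λ v~u → to (N⇔∈ u) (v~u , dist-one v~u)) (proj₁ ∘ from (N⇔∈ u))

  induced-path : ∀ {v w e} → 2 ≤ e → Dist X v w e → InducedPath X
  induced-path (s≤s (s≤s {n = e} _)) (step v~u (step u~t walk) , minimal) = record
    { x = _ ; y = _ ; z = _ ; x~y = v~u ; y~z = u~t
    ; x≢z = λ { refl → minimal e (s≤s (ℕP.n≤1+n e)) walk }
    ; x≁z = λ v~t → minimal (suc e) ℕP.≤-refl (step v~t walk) }

  card-pos : ∀ {P c u} → Card X P c → P u → 1 ≤ c
  card-pos ([] , _ , P⇔∈) pu with to (P⇔∈ _) pu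
  ... | ()
  card-pos (_ ∷ _ , _) _ = s≤s z≤n

  card-single : ∀ {P u w} → Card X P 1 → P u → P w → u ≡ w
  card-single {u = u} {w} (_ ∷ [] , _ , P⇔∈) pu pw with to (P⇔∈ u) pu | to (P⇔∈ w) pw
  ... | here u≡x | here w≡x = trans u≡x (sym w≡x)

  card-other : ∀ {P c} → Card X P c → 2 ≤ c → ∀ v → ∃[ z ] (P z × z ≢ v)
  card-other (x₁ ∷ x₂ ∷ _ , (x₁∉ ∷ _) , P⇔∈) (s≤s (s≤s _)) v with x₁ ≟ v
  ... | no x₁≢v   = x₁ , from (P⇔∈ x₁) (here refl) , x₁≢v
  ... | yes x₁≡v  = x₂ , from (P⇔∈ x₂) (there (here refl)) ,
                    λ x₂≡v → All.lookup x₁∉ (here refl) (trans x₁≡v (sym x₂≡v))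

  class-constant : ∀ {v r} ((f , _) : NbhdUnionOfCliques X v r) →
    ∀ {u w} → LocalPath X v u w → (p : Adj X v u) (q : Adj X v w) → f u p ≡ f w q
  class-constant (f , _ , _) here p q = cong (f _) (T-irrelevant p q)
  class-constant U@(f , _ , same⇔adj) (there v~t u~t path) p q =
    trans (to (same⇔adj _ _ p v~t (adj-≢ u~t)) u~t) (class-constant U path v~t q)

  union-disconnected : ∀ {v r} → NbhdUnionOfCliques X v r → 2 ≤ r → ¬ NbhdConnected X v
  union-disconnected U@(f , occurs , _) (s≤s (s≤s _)) connected
    with occurs zero | occurs (suc zero)
  ... | u₁ , p₁ , u₁↦0 | u₂ , p₂ , u₂↦1
    with trans (sym u₁↦0) (trans (class-constant U (connected u₁ u₂ p₁ p₂) p₁ p₂) u₂↦1)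
  ...   | ()

  union-separates : ∀ {v r u w} → NbhdUnionOfCliques X v r → Adj X v u → Adj X v w →
                    u ≢ w → ¬ Adj X u w → 2 ≤ r
  union-separates {r = r} (f , _ , same⇔adj) p q u≢w u≁w =
    distinct (f _ p) (f _ q) (λ same → u≁w (from (same⇔adj _ _ p q u≢w) same))
    where
    distinct : ∀ {r} (i j : Fin r) → i ≢ j → 2 ≤ r
    distinct {suc zero}    zero zero i≢j = contradiction refl i≢j
    distinct {suc (suc _)} _    _    _   = s≤s (s≤s z≤n)

module Geometry {n} (X : Graph n) {k : ℕ} {m : ℚ} {N : ℕ} (𝒞 : Fin N → Subset n)
                (geo : IsDelsarteGeometry X k m 𝒞) where
  open Graph X
  open GraphFacts X

  clique : ∀ i → IsClique X (𝒞 i)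
  clique i = proj₁ (proj₁ geo i)

  delsarte : ∀ i → (fromℕ ∣ 𝒞 i ∣ - 1ℚ) *ℚ m ≡ fromℕ k
  delsarte i = proj₂ (proj₁ geo i)

  line : ∀ {u v} → Adj X u v → Fin N
  line {u} {v} u~v = proj₁ (proj₂ geo u v u~v)

  line-∋ˡ : ∀ {u v} (u~v : Adj X u v) → u ∈ 𝒞 (line u~v)
  line-∋ˡ {u} {v} u~v = proj₁ (proj₁ (proj₂ (proj₂ geo u v u~v)))

  line-∋ʳ : ∀ {u v} (u~v : Adj X u v) → v ∈ 𝒞 (line u~v)
  line-∋ʳ {u} {v} u~v = proj₂ (proj₁ (proj₂ (proj₂ geo u v u~v)))

  line-unique : ∀ {u v} (u~v : Adj X u v) j → u ∈ 𝒞 j → v ∈ 𝒞 j → j ≡ line u~v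
  line-unique {u} {v} u~v = proj₂ (proj₂ (proj₂ geo u v u~v))

  on-line : ∀ {i u w} → u ∈ 𝒞 i → w ∈ 𝒞 i → u ≢ w → Adj X u w
  on-line {i} = clique i _ _

  sees : ∀ {ψ} → IsPsi1 X 𝒞 ψ → ∀ {i w u} → w ∉ 𝒞 i → u ∈ 𝒞 i → Adj X w u →
         Card X (λ y → y ∈ 𝒞 i × Adj X w y) ψ
  sees psi {i} {w} {u} w∉ u∈ w~u = psi i w (w∉ , u , u∈ , w~u)

  -- ψ₁ ≥ 1: the end z of an induced path x – y – z lies off the line of
  -- xy and sees its point y.
  psi-positive : ∀ {ψ} → IsPsi1 X 𝒞 ψ → InducedPath X → 1 ≤ ψ
  psi-positive psi path = card-pos (sees psi z∉ (line-∋ʳ x~y) (adj-sym y~z)) (line-∋ʳ x~y , adj-sym y~z)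
    where
    open InducedPath path
    z∉ : z ∉ 𝒞 (line x~y)
    z∉ z∈ = x≁z (on-line (line-∋ˡ x~y) z∈ x≢z)

  triangle-on-line : IsPsi1 X 𝒞 1 → ∀ {v u w} (v~u : Adj X v u) →
                     Adj X v w → Adj X u w → w ∈ 𝒞 (line v~u)
  triangle-on-line psi v~u v~w u~w with _ ∈? 𝒞 (line v~u)
  ... | yes w∈ = w∈
  ... | no w∉  = contradiction
    (card-single (sees psi w∉ (line-∋ˡ v~u) (adj-sym v~w))
                 (line-∋ˡ v~u , adj-sym v~w) (line-∋ʳ v~u , adj-sym u~w))
    (adj-≢ v~u)

  -- If ψ₁ ≥ 2, every neighbourhood graph is connected: a neighbour w of v
  -- off the line L of vu sees a point t ≠ v of L, and u – t – w is a local
  -- path (t = u is allowed, giving u – w).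
  neighbourhood-connected : ∀ {ψ} → IsPsi1 X 𝒞 ψ → 2 ≤ ψ → ∀ v → NbhdConnected X v
  neighbourhood-connected psi 2≤ψ v u w v~u v~w with w ∈? 𝒞 (line v~u) | u ≟ w
  ... | _      | yes refl = here
  ... | yes w∈ | no u≢w   = there v~w (on-line (line-∋ʳ v~u) w∈ u≢w) here
  ... | no w∉  | no _ with card-other (sees psi w∉ (line-∋ˡ v~u) (adj-sym v~w)) 2≤ψ v
  ...   | t , (t∈ , w~t) , t≢v with u ≟ t
  ...     | yes refl = there v~w (adj-sym w~t) here
  ...     | no u≢t   = there (on-line (line-∋ˡ v~u) t∈ (λ v≡t → t≢v (sym v≡t)))
                             (on-line (line-∋ʳ v~u) t∈ u≢t)
                             (there v~w (adj-sym w~t) here)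

  uniform-lines : k ≢ 0 → ∀ {x i} → x ∈ 𝒞 i →
    Σ[ s ∈ ℕ ] ((∀ j → ∣ 𝒞 j ∣ ≡ suc s) × fromℕ s *ℚ m ≡ fromℕ k)
  uniform-lines k≢0 {i = i} x∈ with nonempty-size x∈
  ... | s , size-i = s
      , (λ j → trans (delsarte-equal {∣ 𝒞 j ∣} {∣ 𝒞 i ∣} {k} k≢0 (delsarte j) (delsarte i)) size-i)
      , delsarte-pred {s} {k} (subst (λ S → (fromℕ S - 1ℚ) *ℚ m ≡ fromℕ k) size-i (delsarte i))

  module Lines (s : ℕ) (size : ∀ i → ∣ 𝒞 i ∣ ≡ suc s) (s·m≡k : fromℕ s *ℚ m ≡ fromℕ k)
               (k≢0 : k ≢ 0) (deg : ∀ v → count (adj v) ≡ k) where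

    lines : Fin n → ℕ
    lines v = count (λ i → lookup (𝒞 i) v)

    others : ∀ {v i} → v ∈ 𝒞 i → count (lookup (𝒞 i) ∖ v) ≡ s
    others {v} {i} v∈ = ℕP.suc-injective (begin
      suc (count (lookup (𝒞 i) ∖ v)) ≡⟨ sym (count-remove (lookup (𝒞 i)) v (∈⇒T v∈)) ⟩
      count (lookup (𝒞 i))           ≡⟨ sym (size-count (𝒞 i)) ⟩
      ∣ 𝒞 i ∣                        ≡⟨ size i ⟩
      suc s                          ∎)
      where open ≡-Reasoning

    -- Double counting the pairs (L, u) with v, u ∈ L and u ≠ v: the lines
    -- through v partition the neighbourhood of v, so k = r(v)·s.
    degree-lines : ∀ v → count (adj v) ≡ lines v * s
    degree-lines v = begin
      count (adj v)                       ≡⟨ sum-cong-≗ (λ u → sym (per-neighbour u)) ⟩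
      sum (λ u → count (pair u))          ≡⟨ sym (∑-comm (λ i u → ⟦ pair u i ⟧)) ⟩
      sum (λ i → count (λ u → pair u i))  ≡⟨ sum-cong-≗ per-line ⟩
      sum (λ i → ⟦ lookup (𝒞 i) v ⟧ * s)  ≡⟨ sym (*-distribʳ-sum s (λ i → ⟦ lookup (𝒞 i) v ⟧)) ⟩
      lines v * s                         ∎
      where
      open ≡-Reasoning
      pair : Fin n → Fin N → Bool
      pair u i = lookup (𝒞 i) v ∧ (lookup (𝒞 i) ∖ v) u

      pair-intro : ∀ {u i} → v ∈ 𝒞 i → u ∈ 𝒞 i → u ≢ v → T (pair u i)
      pair-intro {i = i} v∈ u∈ u≢v = from T-∧ (∈⇒T v∈ , ∖-intro (lookup (𝒞 i)) (∈⇒T u∈) u≢v)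

      pair-elim : ∀ {u i} → T (pair u i) → v ∈ 𝒞 i × u ∈ 𝒞 i × u ≢ v
      pair-elim {i = i} t with to T-∧ t
      ... | v∈ , u∈∖ with ∖-elim (lookup (𝒞 i)) u∈∖
      ...   | u∈ , u≢v = T⇒∈ v∈ , T⇒∈ u∈ , u≢v

      per-neighbour : ∀ u → count (pair u) ≡ ⟦ adj v u ⟧
      per-neighbour u with adj v u in v~u
      ... | true  = count-single (pair u) (line t) λ j → mk⇔
          (λ p → let (v∈ , u∈ , _) = pair-elim p in line-unique t j v∈ u∈)
          (λ { refl → pair-intro (line-∋ˡ t) (line-∋ʳ t) (λ u≡v → adj-≢ t (sym u≡v)) })
        where t = from T-≡ v~u
      ... | false = count-none (pair u) λ j p →
          let (v∈ , u∈ , u≢v) = pair-elim p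
          in subst T v~u (on-line v∈ u∈ (λ v≡u → u≢v (sym v≡u)))

      per-line : ∀ i → count (λ u → pair u i) ≡ ⟦ lookup (𝒞 i) v ⟧ * s
      per-line i = trans (count-∧ (lookup (𝒞 i) v) (lookup (𝒞 i) ∖ v)) (contribution i)
        where
        contribution : ∀ i → ⟦ lookup (𝒞 i) v ⟧ * count (lookup (𝒞 i) ∖ v) ≡ ⟦ lookup (𝒞 i) v ⟧ * s
        contribution i with lookup (𝒞 i) v in v∈
        ... | true  = cong (1 *_) (others (T⇒∈ (from T-≡ v∈)))
        ... | false = refl

    lines-through : ∀ v → fromℕ (lines v) ≡ m
    lines-through v = ratio {lines v} {s} {k} k≢0 (trans (sym (deg v)) (degree-lines v)) s·m≡k

    lines-constant : ∀ v w → lines v ≡ lines w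
    lines-constant v w = fromℕ-injective (trans (lines-through v) (sym (lines-through w)))

    -- If ψ₁ = 1, X(v) is the disjoint union of the r(v) cliques L ∖ {v},
    -- L a line through v; a neighbour u is sent to the index of line(vu).
    union-of-lines : IsPsi1 X 𝒞 1 → ∀ v → NbhdUnionOfCliques X v (lines v)
    union-of-lines psi v = class , occurs , same⇔adj
      where
      open Enumeration (enumerate (λ i → lookup (𝒞 i) v))

      s≥1 : 1 ≤ s
      s≥1 = ℕP.n≢0⇒n>0 (natural-factor-≢0 {s} {k} s·m≡k k≢0)

      class : (u : Fin n) → Adj X v u → Fin (lines v)
      class u v~u = index (line v~u) (∈⇒T (line-∋ˡ v~u))

      occurs : ∀ a → ∃[ u ] Σ[ v~u ∈ Adj X v u ] class u v~u ≡ a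
      occurs a with surjective a
      ... | i , v∈ , i↦a with count-witness (lookup (𝒞 i) ∖ v)
                               (subst (1 ≤_) (sym (others (T⇒∈ v∈))) s≥1)
      ...   | u , u∈∖ with ∖-elim (lookup (𝒞 i)) u∈∖
      ...     | u∈ , u≢v = u , v~u , trans (index-cong _ v∈ (sym (line-unique v~u i (T⇒∈ v∈) (T⇒∈ u∈)))) i↦a
        where
        v~u : Adj X v u
        v~u = on-line (T⇒∈ v∈) (T⇒∈ u∈) (λ v≡u → u≢v (sym v≡u))

      same⇔adj : ∀ u w (p : Adj X v u) (q : Adj X v w) → u ≢ w → (Adj X u w ⇔ (class u p ≡ class w q))
      same⇔adj u w p q u≢w = mk⇔ same-class same-line
        where
        same-class : Adj X u w → class u p ≡ class w q
        same-class u~w = index-cong _ _ (line-unique q (line p) (line-∋ˡ p) (triangle-on-line psi p q u~w))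
        same-line : class u p ≡ class w q → Adj X u w
        same-line same = on-line (line-∋ʳ p) w∈ u≢w
          where
          w∈ : w ∈ 𝒞 (line p)
          w∈ = subst (λ i → w ∈ 𝒞 i) (sym (injective (∈⇒T (line-∋ˡ p)) (∈⇒T (line-∋ˡ q)) same)) (line-∋ʳ q)

lemma2p19 : ∀ {n} (X : Graph n) (d : ℕ) (a b c : ℕ → ℕ) → 2 ≤ d →
    IsDRG X d a b c →
    (m : ℚ) → IsSmallestEigenvalue X (- m) →
    {N : ℕ} (𝒞 : Fin N → Subset n) → IsDelsarteGeometry X (b 0) m 𝒞 →
    (ψ : ℕ) → IsPsi1 X 𝒞 ψ →
    ((ψ ≡ 1 → ∀ v → Σ[ r ∈ ℕ ] (toℚ X r ≡ m × NbhdUnionOfCliques X v r))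
    × (2 ≤ ψ → ∀ v → NbhdConnected X v))
    × ((∀ v → NbhdConnected X v) ⊎ (∀ v → ¬ NbhdConnected X v))
lemma2p19 X d a b c 2≤d drg m _ 𝒞 geo ψ psi =
  ((λ ψ≡1 v → lines v , lines-through v , union-of-lines (subst (IsPsi1 X 𝒞) ψ≡1 psi) v)
  , neighbourhood-connected psi)
  , dichotomy ψ psi
  where
  open GraphFacts X
  open Geometry X {b 0} {m} 𝒞 geo
  path : InducedPath X
  path = induced-path 2≤d (proj₂ (proj₂ (proj₂ (proj₁ drg))))
  open InducedPath path
  -- y has the neighbour x, so the degree b₀ is positive
  k≢0 : b 0 ≢ 0
  k≢0 k≡0 = contradiction
    (trans (sym (count-remove (Graph.adj X y) x (adj-sym x~y))) (trans (degree drg y) k≡0)) λ ()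
  uniform : Σ[ s ∈ ℕ ] ((∀ j → ∣ 𝒞 j ∣ ≡ suc s) × fromℕ s *ℚ m ≡ fromℕ (b 0))
  uniform = uniform-lines k≢0 (line-∋ˡ x~y)
  open Lines (proj₁ uniform) (proj₁ (proj₂ uniform)) (proj₂ (proj₂ uniform)) k≢0 (degree drg)
  -- ψ = 0 is impossible; for ψ = 1 the cliques of X(y) separate x and z,
  -- so every vertex lies on r(y) ≥ 2 lines; for ψ ≥ 2 use connectivity.
  dichotomy : ∀ ψ′ → IsPsi1 X 𝒞 ψ′ → (∀ v → NbhdConnected X v) ⊎ (∀ v → ¬ NbhdConnected X v)
  dichotomy zero          psi′ = contradiction (psi-positive psi′ path) λ ()
  dichotomy (suc zero)    psi′ = inj₂ λ v → union-disconnected (union-of-lines psi′ v)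
    (subst (2 ≤_) (lines-constant y v)
      (union-separates (union-of-lines psi′ y) (adj-sym x~y) y~z x≢z x≁z))
  dichotomy (suc (suc _)) psi′ = inj₁ (neighbourhood-connected psi′ (s≤s (s≤s z≤n)))
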